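{- For any finite graph $G$, $\delta(G) \leq \sigma(G)$, where $\delta(G)$ is the minimum degree of $G$.
   Context: Surrounding Cops and Robbers on a finite simple graph $G$ with $k \geq 1$ cops and one robber: the cops first choose starting vertices (several cops may share a vertex), then the robber chooses a starting vertex not occupied by a cop, and thereafter the cops and the robber alternate moves, the cops moving first. In a move, each player may move to an adjacent vertex or stay put; the robber may never move to, or remain on, a vertex occupied by a cop, so if a cop moves onto the robber's vertex the robber is compelled to move to a neighbouring vertex not occupied by a cop. The cops win if at any time every neighbour of the robber's vertex is occupied by a cop; the robber wins if he avoids this forever. Play is with perfect information. The surrounding cop number $\sigma(G)$ is the least number of cops for which the cops have a winning strategy. -}

module Defs where

open import Data.Nat using (ℕ; zero; suc; _⊓_)
open import Data.Fin using (Fin)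
open import Data.Bool using (Bool; true; false; if_then_else_)
open import Data.List using (List; map; allFin; foldr)
open import Data.Nat.ListAction using (sum)
open import Data.Product using (Σ; ∃; _×_; _,_)
open import Data.Sum using (_⊎_)
open import Relation.Binary.PropositionalEquality using (_≡_)
open import Relation.Nullary using (¬_)

record Graph (n : ℕ) : Set where
  field
    adj   : Fin n → Fin n → Bool
    sym   : ∀ u v → adj u v ≡ adj v u
    irrfl : ∀ v → adj v v ≡ false
open Graph public

module _ {n : ℕ} (G : Graph n) where

  degree : Fin n → ℕ
  degree v = sum (map (λ w → if adj G v w then 1 else 0) (allFin n))

  Step : Fin n → Fin n → Set
  Step v v' = (v' ≡ v) ⊎ (adj G v v' ≡ true)

  module _ {k : ℕ} where
    Cops : Set
    Cops = Fin k → Fin n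

    Occupied : Cops → Fin n → Set
    Occupied c w = ∃ λ (i : Fin k) → c i ≡ w

    Surrounded : Cops → Fin n → Set
    Surrounded c r = ∀ w → adj G r w ≡ true → Occupied c w

    CopMove : Cops → Cops → Set
    CopMove c c' = ∀ i → Step (c i) (c' i)

    -- CopsForce c r : it is the cops' turn, cops at c, robber at r; the cops
    -- have a strategy guaranteeing that the robber is surrounded after finitely
    -- many moves (inductive = well-founded winning strategy tree).
    -- A legal robber move from r (after cops moved to c') is r' with Step r r'
    -- and r' unoccupied by c' (so if a cop landed on r he must leave).
    data CopsForce (c : Cops) (r : Fin n) : Set where
      move : (c' : Cops) → CopMove c c' →
             (Surrounded c' r ⊎
              (∀ r' → Step r r' → ¬ Occupied c' r' →
                 Surrounded c' r' ⊎ CopsForce c' r')) →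
             CopsForce c r

  CopsWin : ℕ → Set
  CopsWin k = Σ (Cops {k}) λ c₀ →
    ∀ r → ¬ Occupied c₀ r → Surrounded c₀ r ⊎ CopsForce c₀ r

minDegree : {m : ℕ} → Graph (suc m) → ℕ
minDegree {m} G = foldr _⊓_ (degree G Fin.zero) (map (degree G) (allFin (suc m)))
  where import Data.Fin as Fin

module Submission where

-- Idea: whatever strategy k cops use, a robber who always steps to some
-- unoccupied neighbour (and starts on any unoccupied vertex) can only be
-- caught in a position where he is surrounded.  So a winning strategy of the
-- cops reaches a configuration in which all neighbours of some vertex r are
-- occupied by the k cops; the neighbours of r are then at most k in number,
-- so δ(G) ≤ deg r ≤ k.

open import Defs hiding (sym)
open import Data.Nat using (ℕ; zero; suc; _+_; _⊓_; _≤_; z≤n)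
open import Data.Nat.Properties
  using (+-mono-≤; m≤m+n; m≤n+m; ≤-trans; m⊓n≤m; m⊓n≤n; +-0-commutativeMonoid; module ≤-Reasoning)
open import Data.Fin using (Fin; zero; suc)
open import Data.Fin.Properties using (_≟_; any?)
open import Data.Bool using (Bool; true; false; if_then_else_)
open import Data.Bool.Properties using () renaming (_≟_ to _≟ᵇ_)
open import Data.List using (_∷_; map; allFin; tabulate; foldr)
open import Data.List.Properties using (map-tabulate)
open import Data.List.Membership.Propositional using (_∈_)
open import Data.List.Membership.Propositional.Properties using (∈-allFin; ∈-map⁺)
open import Data.List.Relation.Unary.Any using (here; there)
import Data.Nat.ListAction as List
open import Data.Product using (Σ; ∃; _×_; _,_)
open import Data.Sum using (_⊎_; inj₁; inj₂)
open import Function using (_∘_; id)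
open import Relation.Binary.PropositionalEquality using (_≡_; refl; sym; cong; subst)
open import Relation.Nullary using (¬_; Dec; does)
open import Relation.Nullary.Decidable using (yes; no; _×-dec_; ¬?; dec-true; decidable-stable)
open import Algebra.Properties.CommutativeMonoid.Sum +-0-commutativeMonoid
  using (sum; sum-syntax; sum-cong-≗; sum-replicate-zero; ∑-comm)

[_] : Bool → ℕ
[ b ] = if b then 1 else 0

sum-allFin : ∀ n (f : Fin n → ℕ) → List.sum (map f (allFin n)) ≡ ∑[ i < n ] f i
sum-allFin n f = subst (λ xs → List.sum xs ≡ ∑[ i < n ] f i)
                       (sym (map-tabulate id f)) (sum-tabulate n f)
  where
  sum-tabulate : ∀ n (f : Fin n → ℕ) → List.sum (tabulate f) ≡ ∑[ i < n ] f i
  sum-tabulate zero    f = refl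
  sum-tabulate (suc n) f = cong (f zero +_) (sum-tabulate n (f ∘ suc))

∑-mono-≤ : ∀ {n} (f g : Fin n → ℕ) → (∀ i → f i ≤ g i) → sum f ≤ sum g
∑-mono-≤ {zero}  f g f≤g = z≤n
∑-mono-≤ {suc n} f g f≤g = +-mono-≤ (f≤g zero) (∑-mono-≤ (f ∘ suc) (g ∘ suc) (f≤g ∘ suc))

term≤∑ : ∀ {n} (f : Fin n → ℕ) (i : Fin n) → f i ≤ sum f
term≤∑ f zero    = m≤m+n _ _
term≤∑ f (suc i) = ≤-trans (term≤∑ (f ∘ suc) i) (m≤n+m _ _)

∑-ones : ∀ n → ∑[ i < n ] 1 ≡ n
∑-ones zero    = refl
∑-ones (suc n) = cong suc (∑-ones n)

∑-point : ∀ {n} (v : Fin n) → ∑[ w < n ] [ does (v ≟ w) ] ≡ 1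
∑-point {suc n} zero    = cong suc (sum-replicate-zero n)
∑-point {suc n} (suc v) = ∑-point v

covered-count≤ : ∀ {n k} (P : Fin n → Bool) (c : Fin k → Fin n) →
                 (∀ w → P w ≡ true → ∃ λ i → c i ≡ w) →
                 ∑[ w < n ] [ P w ] ≤ k
covered-count≤ {n} {k} P c covered = begin
  ∑[ w < n ] [ P w ]                           ≤⟨ ∑-mono-≤ _ _ hits ⟩
  ∑[ w < n ] ∑[ i < k ] [ does (c i ≟ w) ]     ≡⟨ ∑-comm (λ w i → [ does (c i ≟ w) ]) ⟩
  ∑[ i < k ] ∑[ w < n ] [ does (c i ≟ w) ]     ≡⟨ sum-cong-≗ (∑-point ∘ c) ⟩
  ∑[ i < k ] 1                                 ≡⟨ ∑-ones k ⟩
  k                                            ∎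
  where
  open ≤-Reasoning
  hits : ∀ w → [ P w ] ≤ ∑[ i < k ] [ does (c i ≟ w) ]
  hits w with P w in Pw
  ... | false = z≤n
  ... | true with covered w Pw
  ... | i , ci≡w = subst (_≤ ∑[ i < k ] [ does (c i ≟ w) ])
                         (cong [_] (dec-true (c i ≟ w) ci≡w))
                         (term≤∑ (λ i → [ does (c i ≟ w) ]) i)

foldr-⊓≤ : ∀ (d x : ℕ) xs → x ∈ xs → foldr _⊓_ d xs ≤ x
foldr-⊓≤ d x (y ∷ xs) (here refl) = m⊓n≤m y _
foldr-⊓≤ d x (y ∷ xs) (there x∈xs) = ≤-trans (m⊓n≤n y _) (foldr-⊓≤ d x xs x∈xs)

minDegree≤degree : ∀ {m} (G : Graph (suc m)) v → minDegree G ≤ degree G v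
minDegree≤degree G v = foldr-⊓≤ _ _ _ (∈-map⁺ (degree G) (∈-allFin v))

module Game {n : ℕ} (G : Graph n) {k : ℕ} where

  occupied? : (c : Cops G {k}) (w : Fin n) → Dec (Occupied G c w)
  occupied? c w = any? (λ i → c i ≟ w)

  surrounded⇒degree≤ : ∀ (c : Cops G) r → Surrounded G c r → degree G r ≤ k
  surrounded⇒degree≤ c r surr =
    subst (_≤ k) (sym (sum-allFin n _)) (covered-count≤ (adj G r) c surr)

  robber-reply : ∀ (c : Cops G) r →
                 Surrounded G c r ⊎ ∃ λ r' → Step G r r' × ¬ Occupied G c r'
  robber-reply c r with any? (λ w → (adj G r w ≟ᵇ true) ×-dec ¬? (occupied? c w))
  ... | yes (w , r~w , free) = inj₂ (w , inj₂ r~w , free)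
  ... | no  noFree           = inj₁ λ w r~w →
          decidable-stable (occupied? c w) (λ free → noFree (w , r~w , free))

  SurroundedPosition : Set
  SurroundedPosition = Σ (Cops G {k}) λ c → ∃ λ r → Surrounded G c r

  force⇒surrounded : ∀ (c : Cops G) r → CopsForce G c r → SurroundedPosition
  force⇒surrounded c r (move c' _ (inj₁ surr)) = c' , r , surr
  force⇒surrounded c r (move c' _ (inj₂ respond)) with robber-reply c' r
  ... | inj₁ surr              = c' , r , surr
  ... | inj₂ (r' , step , free) with respond r' step free
  ...   | inj₁ surr = c' , r' , surr
  ...   | inj₂ next = force⇒surrounded c' r' next

  -- A winning cop strategy reaches a surrounded position: the robber starts on
  -- any free vertex; if there is none, every vertex is surrounded.
  win⇒surrounded : Fin n → CopsWin G k → SurroundedPosition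
  win⇒surrounded v (c₀ , start) with any? (λ r → ¬? (occupied? c₀ r))
  ... | yes (r , free) with start r free
  ...   | inj₁ surr  = c₀ , r , surr
  ...   | inj₂ force = force⇒surrounded c₀ r force
  win⇒surrounded v (c₀ , start) | no noFree =
    c₀ , v , λ w _ → decidable-stable (occupied? c₀ w) (λ free → noFree (w , free))

lemma2 : {m : ℕ} (G : Graph (suc m)) (k : ℕ) → 1 ≤ k → CopsWin G k → minDegree G ≤ k
lemma2 G k _ win with Game.win⇒surrounded G zero win
... | c , r , surr = ≤-trans (minDegree≤degree G r) (Game.surrounded⇒degree≤ G c r surr)
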